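{- Let $k\in\mathbb{N}$ with $\gcd(k,6)=2$, let $h$ be an integer with $\gcd(h,k)=1$, and let $h'$ be an integer with $hh'\equiv-1\pmod k$ and $3\mid h'$. Then \[ \frac{\omega_{h,k}\,\omega_{h,\frac k2}\,\omega_{3h,k}}{\omega_{3h,\frac k2}} = e^{\frac{2\pi i}{k}\left(\frac{k(k+2)}{8}h-\frac{k^2+2}{18}h'\right)}. \]
   Context: For integers $a,c$ with $c\ge1$ and $\gcd(a,c)=1$, let $a'$ be any integer with $aa'\equiv-1\pmod c$ and set \[ \omega_{a,c} := \begin{cases} \left(\frac{ -c}{a}\right)e^{ -\pi i\left(\frac14(2-ac-a)+\frac{1}{12}\left(c-\frac1c\right)\left(2a-a'+a^2a'\right)\right)} & \text{if }a\text{ is odd},\\ \left(\frac{ -a}{c}\right)e^{ -\pi i\left(\frac14(c-1)+\frac{1}{12}\left(c-\frac1c\right)\left(2a-a'+a^2a'\right)\right)} & \text{if }c\text{ is odd}, \end{cases} \] where $\left(\frac{\cdot}{\cdot}\right)$ is the Kronecker symbol; $\omega_{a,c}$ depends only on $a\bmod c$. -}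

module Defs where

open import Data.Bool using (Bool; true; false; if_then_else_; _∨_; _∧_)
open import Data.Nat as ℕ using (ℕ; zero; suc; _≡ᵇ_; _<ᵇ_)
import Data.Nat.DivMod as ℕD
open import Data.Integer as ℤ using (ℤ; +_; -[1+_]; ∣_∣; _%ℕ_)
open import Data.Rational.Unnormalised as Q using (ℚᵘ; mkℚᵘ)
open import Data.Product using (_×_; _,_; ∃)
open import Data.Sum using (_⊎_)
open import Relation.Binary.PropositionalEquality using (_≡_)

isSquareMod : (p : ℕ) .{{_ : ℕ.NonZero p}} → ℕ → ℕ → Bool
isSquareMod p r zero    = false
isSquareMod p r (suc x) = ((x ℕ.* x) ℕD.% p ≡ᵇ r) ∨ isSquareMod p r x

legendre : ℤ → (p : ℕ) .{{_ : ℕ.NonZero p}} → ℤ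
legendre a p with a %ℕ p
... | zero  = + 0
... | suc r = if isSquareMod p (suc r) p then + 1 else -[1+ 0 ]

kron2 : ℤ → ℤ
kron2 a with a %ℕ 8
... | 1 = + 1
... | 7 = + 1
... | 3 = -[1+ 0 ]
... | 5 = -[1+ 0 ]
... | _ = + 0

kronPrime : ℤ → (p : ℕ) .{{_ : ℕ.NonZero p}} → ℤ
kronPrime a p = if p ≡ᵇ 2 then kron2 a else legendre a p

-- least divisor ≥ 2 + e of n (search with fuel); result d written as 2 + d.
-- For n ≥ 2, leastDivFrom n 0 n returns (smallest prime factor of n) - 2.
leastDivFrom : ℕ → ℕ → ℕ → ℕ
leastDivFrom n e zero       = e
leastDivFrom n e (suc fuel) =
  if n ℕD.% (suc (suc e)) ≡ᵇ 0 then e else leastDivFrom n (suc e) fuel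

kronPos : ℕ → ℤ → ℕ → ℤ
kronPos zero       a n = + 1
kronPos (suc fuel) a n =
  if n ℕ.<ᵇ 2 then + 1 else
    (let p = suc (suc (leastDivFrom n 0 n)) in
     kronPrime a p ℤ.* kronPos fuel a (n ℕD./ p))

kronecker : ℤ → ℤ → ℤ
kronecker a (+ zero)    = if ∣ a ∣ ≡ᵇ 1 then + 1 else + 0
kronecker a (+ suc n)   = kronPos (suc n) a (suc n)
kronecker a -[1+ n ]    =
  signSym a ℤ.* kronPos (suc n) a (suc n)
  where
  signSym : ℤ → ℤ
  signSym (+ _)    = + 1
  signSym -[1+ _ ] = -[1+ 0 ]

-- Complex numbers of the form s · e^{2πi q} with s ∈ ℤ, q ∈ ℚ.

SU : Set
SU = ℤ × ℚᵘ

infixl 7 _·_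
infix 4 _≈_
infix 7 _÷_

_·_ : SU → SU → SU
(s , q) · (t , r) = (s ℤ.* t , q Q.+ r)

_≡mod1_ : ℚᵘ → ℚᵘ → Set
q ≡mod1 r = ∃ λ (n : ℤ) → q Q.- r Q.≃ mkℚᵘ n 0

_≈_ : SU → SU → Set
(s , q) ≈ (t , r) =
  (s ≡ + 0 × t ≡ + 0)
  ⊎ ((s ≡ t × ¬0 s) × q ≡mod1 r)
  ⊎ ((s ≡ ℤ.- t × ¬0 s) × q ≡mod1 (r Q.+ mkℚᵘ (+ 1) 1))
  where
  open import Relation.Nullary using (¬_)
  ¬0 : ℤ → Set
  ¬0 x = ¬ (x ≡ + 0)

e : ℚᵘ → SU
e q = (+ 1 , q)

-- n / d as an unnormalised rational, for d ≥ 1 (d = 0 is never used).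
_÷_ : ℤ → ℕ → ℚᵘ
n ÷ d = mkℚᵘ n (ℕ.pred d)

-- ω_{a,c} computed with a chosen a' (a a' ≡ -1 mod c), c ≥ 1.
-- ω = sym · e^{-πi X} = sym · e^{2πi (-X/2)}.

-- (1/12)(c - 1/c)(2a - a' + a² a') = (c² - 1)(2a - a' + a² a') / (12 c)
omegaTail : ℤ → ℕ → ℤ → ℚᵘ
omegaTail a c a' =
  ((+ (c ℕ.* c) ℤ.- + 1) ℤ.* (+ 2 ℤ.* a ℤ.- a' ℤ.+ a ℤ.* a ℤ.* a')) ÷ (12 ℕ.* c)

omega : ℤ → ℕ → ℤ → SU
omega a c a' =
  if ∣ a ∣ ℕD.% 2 ≡ᵇ 1
  then (kronecker (ℤ.- (+ c)) a ,
        Q.- ((((+ 2 ℤ.- a ℤ.* + c ℤ.- a) ÷ 4) Q.+ omegaTail a c a') Q.* mkℚᵘ (+ 1) 1))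
  else (kronecker (ℤ.- a) (+ c) ,
        Q.- ((((+ c ℤ.- + 1) ÷ 4) Q.+ omegaTail a c a') Q.* mkℚᵘ (+ 1) 1))

{-# OPTIONS --safe #-}
-- Since h is coprime to the even number k, both h and 3h are odd, so all four ω's are given by
-- the first case of their definition. Their signs are Kronecker symbols: with m = k/2, one has
-- (-k/3h) = (-k/3)(-k/h), (-k/h)² = 1 because gcd(h,k) = 1, and (-k/3) = -(-m/3) because
-- (2/3) = -1. So the two sides have opposite signs, and it remains to show that their phases
-- differ by 1/2 modulo 1.
-- Inverses modulo c are unique, hence a₁ = h' + u₁k, a₂ = h' + u₂m, a₃ = s + u₃k and
-- a₄ = s + u₄m, where h' = 3s. Over the common denominator 576m the phase difference minus 1/2
-- then has numerator
--   -576m - 24m(h²-1)((k²-1)u₁ + (m²-1)u₂ + 18ms) - 24m(9h²-1)((k²-1)u₃ - (m²-1)u₄),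
-- which 576m divides, since 8 ∣ h²-1 for odd h and 3 ∣ k²-1, m²-1 as 3 ∤ k.
module Submission where

open import Defs
open import Data.Nat as ℕ using (ℕ; zero; suc)
open import Data.Nat.GCD using (gcd; gcd[m,n]∣m; gcd-greatest)
open import Data.Nat.DivMod using (_/_; _%_)
open import Data.Integer as ℤ using (ℤ; +_; -[1+_]; ∣_∣; _+_; _-_; _*_; -_; _%ℕ_; _/ℕ_)
open import Data.Integer.GCD as ℤG using ()
open import Data.Integer.Divisibility using (_∣_)
open import Data.Rational.Unnormalised as Q using (ℚᵘ; mkℚᵘ; ↥_; ↧_; *≡*)
open import Relation.Binary.PropositionalEquality using (_≡_; _≢_; refl; sym; trans; cong; cong₂; subst; module ≡-Reasoning)

open import Data.Bool using (true; false)
open import Data.Empty using (⊥-elim)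
import Data.Integer.Coprimality as ℤC
import Data.Integer.Divisibility.Signed as ℤˢ
import Data.Integer.DivMod as ℤD
import Data.Integer.Properties as ℤP
open import Algebra.Properties.CommutativeSemigroup ℤP.*-commutativeSemigroup using (xy∙z≈xz∙y; x∙yz≈y∙xz)
open import Data.Integer.Tactic.RingSolver using (solve-∀; solve)
open import Data.List using (_∷_; [])
open import Data.Nat.Coprimality as ℕC using (Coprime)
open import Data.Nat.Divisibility as ℕᵈ using () renaming (_∣_ to _∣ₙ_)
import Data.Nat.DivMod as ℕD
open import Data.Nat.Primality using (Prime; prime?; prime⇒irreducible)
import Data.Nat.Properties as ℕP
open import Data.Product using (∃; _,_)
open import Data.Sum using (inj₁; inj₂)
open import Relation.Nullary using (¬_; yes; no; contradiction)
open import Relation.Nullary.Decidable using (from-yes; from-no)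

-- Elementary number theory

¬2∣⇒%2≡1 : ∀ n → ¬ 2 ∣ₙ n → n % 2 ≡ 1
¬2∣⇒%2≡1 n 2∤n with n % 2 in n%2≡r | ℕD.m%n<n n 2
... | 0 | _ = ⊥-elim (2∤n (ℕᵈ.m%n≡0⇒n∣m n 2 n%2≡r))
... | 1 | _ = refl
... | suc (suc _) | ℕ.s≤s (ℕ.s≤s ())

coprime-∣ˡ : ∀ {m n} o → m ∣ₙ n → Coprime n o → Coprime m o
coprime-∣ˡ o m∣n n⊥o (d∣m , d∣o) = n⊥o (ℕᵈ.∣-trans d∣m m∣n , d∣o)

coprime-*ʳ : ∀ {m n o} → Coprime m n → Coprime m o → Coprime m (n ℕ.* o)
coprime-*ʳ m⊥n m⊥o (d∣m , d∣no) = m⊥o (d∣m , ℕC.coprime-divisor (coprime-∣ˡ _ d∣m m⊥n) d∣no)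

¬∣⇒coprime : ∀ {p n} → Prime p → ¬ p ∣ₙ n → Coprime n p
¬∣⇒coprime p-prime p∤n (d∣n , d∣p) with prime⇒irreducible p-prime d∣p
... | inj₁ d≡1 = d≡1
... | inj₂ refl = ⊥-elim (p∤n d∣n)

infix 4 _≡[mod_]_

_≡[mod_]_ : ℤ → ℤ → ℤ → Set
x ≡[mod c ] y = ∃ λ u → x ≡ y + u * c

inverse-unique : ∀ c a x y → ℤC.Coprime c a → c ∣ a * x + + 1 → c ∣ a * y + + 1 → x ≡[mod c ] y
inverse-unique c a x y c⊥a c∣ax+1 c∣ay+1 = ℤˢ.quotient c∣x-y , (begin
  x                          ≡⟨ solve (x ∷ y ∷ []) ⟩
  y + (x - y)                ≡⟨ cong (λ d → y + d) (ℤˢ._∣_.equality c∣x-y) ⟩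
  y + ℤˢ.quotient c∣x-y * c  ∎)
  where
  open ≡-Reasoning
  difference : ∀ a x y → (a * x + + 1) - (a * y + + 1) ≡ a * (x - y)
  difference = solve-∀
  c∣a[x-y] : c ∣ a * (x - y)
  c∣a[x-y] = ℤˢ.∣⇒∣ᵤ (subst (c ℤˢ.∣_) (difference a x y)
    (ℤˢ.∣m∣n⇒∣m-n {c} {a * x + + 1} {a * y + + 1} (ℤˢ.∣ᵤ⇒∣ c∣ax+1) (ℤˢ.∣ᵤ⇒∣ c∣ay+1)))
  c∣x-y : c ℤˢ.∣ x - y
  c∣x-y = ℤˢ.∣ᵤ⇒∣ (ℤC.coprime-divisor c a (x - y) c⊥a c∣a[x-y])

¬2∣⇒8∣i*i-1 : ∀ i → ¬ (+ 2 ∣ i) → + 8 ℤˢ.∣ i * i - + 1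
¬2∣⇒8∣i*i-1 i 2∤i = by-residue (i %ℕ 4) (i /ℕ 4) (ℤD.n%ℕd<d i 4) (ℤD.a≡a%ℕn+[a/ℕn]*n i 4)
  where
  2∣i : ∀ q → i ≡ q * + 2 → + 2 ∣ i
  2∣i q i≡2q = ℤˢ.∣⇒∣ᵤ {+ 2} (ℤˢ.divides q i≡2q)
  i*i-1≡ : ∀ {j} → i ≡ j → i * i - + 1 ≡ j * j - + 1
  i*i-1≡ = cong (λ x → x * x - + 1)
  by-residue : ∀ r q → r ℕ.< 4 → i ≡ + r + q * + 4 → + 8 ℤˢ.∣ i * i - + 1
  by-residue 0 q _ i≡ = ⊥-elim (2∤i (2∣i (q * + 2) (trans i≡ (solve (q ∷ [])))))
  by-residue 1 q _ i≡ = ℤˢ.divides (q + q * q * + 2) (trans (i*i-1≡ i≡) (solve (q ∷ [])))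
  by-residue 2 q _ i≡ = ⊥-elim (2∤i (2∣i (+ 1 + q * + 2) (trans i≡ (solve (q ∷ [])))))
  by-residue 3 q _ i≡ = ℤˢ.divides (+ 1 + q * + 3 + q * q * + 2) (trans (i*i-1≡ i≡) (solve (q ∷ [])))
  by-residue (suc (suc (suc (suc _)))) _ (ℕ.s≤s (ℕ.s≤s (ℕ.s≤s (ℕ.s≤s ())))) _

¬3∣⇒3∣i*i-1 : ∀ i → ¬ (+ 3 ∣ i) → + 3 ℤˢ.∣ i * i - + 1
¬3∣⇒3∣i*i-1 i 3∤i = by-residue (i %ℕ 3) (i /ℕ 3) (ℤD.n%ℕd<d i 3) (ℤD.a≡a%ℕn+[a/ℕn]*n i 3)
  where
  i*i-1≡ : ∀ {j} → i ≡ j → i * i - + 1 ≡ j * j - + 1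
  i*i-1≡ = cong (λ x → x * x - + 1)
  by-residue : ∀ r q → r ℕ.< 3 → i ≡ + r + q * + 3 → + 3 ℤˢ.∣ i * i - + 1
  by-residue 0 q _ i≡ = ⊥-elim (3∤i (ℤˢ.∣⇒∣ᵤ {+ 3} (ℤˢ.divides q (trans i≡ (solve (q ∷ []))))))
  by-residue 1 q _ i≡ = ℤˢ.divides (q * + 2 + q * q * + 3) (trans (i*i-1≡ i≡) (solve (q ∷ [])))
  by-residue 2 q _ i≡ = ℤˢ.divides (+ 1 + q * + 4 + q * q * + 3) (trans (i*i-1≡ i≡) (solve (q ∷ [])))
  by-residue (suc (suc (suc _))) _ (ℕ.s≤s (ℕ.s≤s (ℕ.s≤s ()))) _

-- Kronecker symbols

leastDivFrom-∣ : ∀ n f e → 2 ℕ.+ e ℕ.≤ n → n ℕ.≤ f ℕ.+ (2 ℕ.+ e) →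
                 2 ℕ.+ leastDivFrom n e f ∣ₙ n
leastDivFrom-∣ n zero e 2+e≤n n≤2+e = subst (_∣ₙ n) (ℕP.≤-antisym n≤2+e 2+e≤n) ℕᵈ.∣-refl
leastDivFrom-∣ n (suc f) e 2+e≤n n≤f+2+e with n % (2 ℕ.+ e) in n%[2+e]
... | zero  = ℕᵈ.m%n≡0⇒n∣m n (2 ℕ.+ e) n%[2+e]
... | suc _ =
  leastDivFrom-∣ n f (suc e) 3+e≤n (subst (n ℕ.≤_) (sym (ℕP.+-suc f (2 ℕ.+ e))) n≤f+2+e)
  where
  3+e≤n : 3 ℕ.+ e ℕ.≤ n
  3+e≤n = ℕP.≤∧≢⇒< 2+e≤n λ { refl → ℕP.0≢1+n (trans (sym (ℕD.n%n≡0 n)) n%[2+e]) }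

kronPos-fuel : ∀ x {f g} n → n ℕ.≤ f → n ℕ.≤ g → kronPos f x n ≡ kronPos g x n
kronPos-fuel x {zero}  {zero}  _ _ _ = refl
kronPos-fuel x {zero}  {suc _} 0 _ _ = refl
kronPos-fuel x {suc _} {zero}  0 _ _ = refl
kronPos-fuel x {suc _} {suc _} 0 _ _ = refl
kronPos-fuel x {suc _} {suc _} 1 _ _ = refl
kronPos-fuel x {suc f} {suc g} n@(suc (suc n-2)) (ℕ.s≤s n≤f) (ℕ.s≤s n≤g) =
  cong (kronPrime x p *_) (kronPos-fuel x (n / p) (ℕP.≤-trans n/p≤n-1 n≤f) (ℕP.≤-trans n/p≤n-1 n≤g))
  where
  p = 2 ℕ.+ leastDivFrom n 0 n
  n/p≤n-1 : n / p ℕ.≤ suc n-2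
  n/p≤n-1 = ℕP.≤-pred (ℕD.m/n<m n p (ℕ.s≤s (ℕ.s≤s ℕ.z≤n)))

leastDivFrom-3 : ∀ n f → n % 2 ≡ 1 → n % 3 ≡ 0 → leastDivFrom n 0 (2 ℕ.+ f) ≡ 1
leastDivFrom-3 n f n%2≡1 n%3≡0 rewrite n%2≡1 | n%3≡0 = refl

-- kronPos first splits off the least prime factor, which for 3n with n odd is 3.
kronPos-3* : ∀ x n → n % 2 ≡ 1 → kronPos (3 ℕ.* n) x (3 ℕ.* n) ≡ kronPrime x 3 * kronPos n x n
kronPos-3* x n@(suc n-1) n%2≡1 = begin
  kronPos (3 ℕ.* n) x (3 ℕ.* n)
    ≡⟨ cong (λ t → kronPos t x t) 3n≡T ⟩
  kronPos T x T
    ≡⟨ cong (λ l → kronPrime x (2 ℕ.+ l) * kronPos (2 ℕ.+ 3 ℕ.* n-1) x (T / (2 ℕ.+ l)))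
            (leastDivFrom-3 T (1 ℕ.+ 3 ℕ.* n-1) T%2≡1 T%3≡0) ⟩
  kronPrime x 3 * kronPos (2 ℕ.+ 3 ℕ.* n-1) x (T / 3)
    ≡⟨ cong (λ t → kronPrime x 3 * kronPos (2 ℕ.+ 3 ℕ.* n-1) x t) T/3≡n ⟩
  kronPrime x 3 * kronPos (2 ℕ.+ 3 ℕ.* n-1) x n
    ≡⟨ cong (kronPrime x 3 *_) (kronPos-fuel x n n≤2+3[n-1] ℕP.≤-refl) ⟩
  kronPrime x 3 * kronPos n x n ∎
  where
  open ≡-Reasoning
  T = 3 ℕ.+ 3 ℕ.* n-1
  3n≡T : 3 ℕ.* n ≡ T
  3n≡T = ℕP.*-suc 3 n-1
  T%2≡1 : T % 2 ≡ 1
  T%2≡1 = subst (λ t → t % 2 ≡ 1) 3n≡T (trans (ℕD.%-distribˡ-* 3 n 2) (cong (λ r → (1 ℕ.* r) % 2) n%2≡1))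
  T%3≡0 : T % 3 ≡ 0
  T%3≡0 = subst (λ t → t % 3 ≡ 0) 3n≡T (trans (cong (_% 3) (ℕP.*-comm 3 n)) (ℕD.m*n%n≡0 n 3))
  T/3≡n : T / 3 ≡ n
  T/3≡n = subst (λ t → t / 3 ≡ n) 3n≡T (trans (cong (_/ 3) (ℕP.*-comm 3 n)) (ℕD.m*n/n≡m n 3))
  n≤2+3[n-1] : n ℕ.≤ 2 ℕ.+ 3 ℕ.* n-1
  n≤2+3[n-1] = ℕ.s≤s (ℕP.m≤n⇒m≤1+n (ℕP.m≤n*m n-1 3))

kronecker-3* : ∀ x h → ∣ h ∣ % 2 ≡ 1 → kronecker x (+ 3 * h) ≡ kronPrime x 3 * kronecker x h
kronecker-3* x (+ suc n) h-odd = kronPos-3* x (suc n) h-odd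
kronecker-3* x@(+ _) -[1+ n ] h-odd =
  trans (cong (+ 1 *_) (kronPos-3* x (suc n) h-odd)) (x∙yz≈y∙xz (+ 1) (kronPrime x 3) _)
kronecker-3* x@(-[1+ _ ]) -[1+ n ] h-odd =
  trans (cong (-[1+ 0 ] *_) (kronPos-3* x (suc n) h-odd)) (x∙yz≈y∙xz -[1+ 0 ] (kronPrime x 3) _)

%ℕ≡0⇒∣ : ∀ x d .{{_ : ℕ.NonZero d}} → x %ℕ d ≡ 0 → + d ∣ x
%ℕ≡0⇒∣ x d x%d≡0 = ℤˢ.∣⇒∣ᵤ {+ d} (ℤˢ.divides (x /ℕ d) (begin
  x                         ≡⟨ ℤD.a≡a%ℕn+[a/ℕn]*n x d ⟩
  + (x %ℕ d) + x /ℕ d * + d ≡⟨ cong (λ r → + r + x /ℕ d * + d) x%d≡0 ⟩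
  + 0 + x /ℕ d * + d        ≡⟨ ℤP.+-identityˡ _ ⟩
  x /ℕ d * + d              ∎))
  where open ≡-Reasoning

kronPrime-unit : ∀ x l → ¬ (+ (3 ℕ.+ l) ∣ x) → ∣ kronPrime x (3 ℕ.+ l) ∣ ≡ 1
kronPrime-unit x l p∤x with x %ℕ (3 ℕ.+ l) in x%p≡r
... | zero  = ⊥-elim (p∤x (%ℕ≡0⇒∣ x (3 ℕ.+ l) x%p≡r))
... | suc r with isSquareMod (3 ℕ.+ l) (suc r) (3 ℕ.+ l)
...   | true  = refl
...   | false = refl

kronPos-unit : ∀ f x n → (∀ l → 2 ℕ.+ l ∣ₙ n → ∣ kronPrime x (2 ℕ.+ l) ∣ ≡ 1) →
               ∣ kronPos f x n ∣ ≡ 1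
kronPos-unit zero    x n                 _     = refl
kronPos-unit (suc f) x 0                 _     = refl
kronPos-unit (suc f) x 1                 _     = refl
kronPos-unit (suc f) x n@(suc (suc n-2)) units = begin
  ∣ kronPrime x p * kronPos f x (n / p) ∣
    ≡⟨ ℤP.abs-* (kronPrime x p) _ ⟩
  ∣ kronPrime x p ∣ ℕ.* ∣ kronPos f x (n / p) ∣
    ≡⟨ cong₂ ℕ._*_ (units l p∣n) (kronPos-unit f x (n / p) units/p) ⟩
  1 ∎
  where
  open ≡-Reasoning
  l = leastDivFrom n 0 n
  p = 2 ℕ.+ l
  p∣n : p ∣ₙ n
  p∣n = leastDivFrom-∣ n n 0 (ℕ.s≤s (ℕ.s≤s ℕ.z≤n)) (ℕP.m≤m+n n 2)
  units/p : ∀ l′ → 2 ℕ.+ l′ ∣ₙ n / p → ∣ kronPrime x (2 ℕ.+ l′) ∣ ≡ 1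
  units/p l′ q∣n/p = units l′ (ℕᵈ.∣-trans q∣n/p (ℕᵈ.m/n∣m p∣n))

kronecker-unit : ∀ x h → h ≢ + 0 →
                 (∀ l → 2 ℕ.+ l ∣ₙ ∣ h ∣ → ∣ kronPrime x (2 ℕ.+ l) ∣ ≡ 1) → ∣ kronecker x h ∣ ≡ 1
kronecker-unit x (+ zero) h≢0 _ = ⊥-elim (h≢0 refl)
kronecker-unit x (+ suc n) _ units = kronPos-unit (suc n) x (suc n) units
kronecker-unit x@(+ _) -[1+ n ] _ units =
  trans (ℤP.abs-* (+ 1) (kronPos (suc n) x (suc n)))
        (trans (ℕP.*-identityˡ _) (kronPos-unit (suc n) x (suc n) units))
kronecker-unit x@(-[1+ _ ]) -[1+ n ] _ units =
  trans (ℤP.abs-* -[1+ 0 ] (kronPos (suc n) x (suc n)))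
        (trans (ℕP.*-identityˡ _) (kronPos-unit (suc n) x (suc n) units))

∣i∣≡1⇒i*i≡1 : ∀ {i} → ∣ i ∣ ≡ 1 → i * i ≡ + 1
∣i∣≡1⇒i*i≡1 {+ .1}         refl = refl
∣i∣≡1⇒i*i≡1 { -[1+ .0 ]}   refl = refl

kronPrime[-n,3]≡-1 : ∀ n → n % 3 ≡ 1 → kronPrime (- + n) 3 ≡ -[1+ 0 ]
kronPrime[-n,3]≡-1 (suc n) n%3≡1 rewrite n%3≡1 = refl

kronPrime[-n,3]≡1 : ∀ n → n % 3 ≡ 2 → kronPrime (- + n) 3 ≡ + 1
kronPrime[-n,3]≡1 (suc n) n%3≡2 rewrite n%3≡2 = refl

kronPrime[-2m,3]≡-kronPrime[-m,3] : ∀ m → ¬ 3 ∣ₙ m → kronPrime (- + (2 ℕ.* m)) 3 ≡ - kronPrime (- + m) 3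
kronPrime[-2m,3]≡-kronPrime[-m,3] m 3∤m with m % 3 in m%3≡r | ℕD.m%n<n m 3 | ℕD.%-distribˡ-* 2 m 3
... | 0 | _ | _     = ⊥-elim (3∤m (ℕᵈ.m%n≡0⇒n∣m m 3 m%3≡r))
... | 1 | _ | 2m%3 = trans (kronPrime[-n,3]≡1 (2 ℕ.* m) 2m%3) (cong -_ (sym (kronPrime[-n,3]≡-1 m m%3≡r)))
... | 2 | _ | 2m%3 = trans (kronPrime[-n,3]≡-1 (2 ℕ.* m) 2m%3) (cong -_ (sym (kronPrime[-n,3]≡1 m m%3≡r)))
... | suc (suc (suc _)) | ℕ.s≤s (ℕ.s≤s (ℕ.s≤s ())) | _

sign-identity : ∀ {s₁ s₂ s₃ s₄ l} → s₁ * s₁ ≡ + 1 → s₃ ≡ - l * s₁ → s₄ ≡ l * s₂ →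
                s₁ * s₂ * s₃ ≡ - (+ 1 * s₄)
sign-identity {s₁} {s₂} {l = l} s₁²≡1 refl refl = begin
  s₁ * s₂ * (- l * s₁)       ≡⟨ solve (s₁ ∷ s₂ ∷ l ∷ []) ⟩
  - (s₁ * s₁ * (l * s₂))     ≡⟨ cong (λ x → - (x * (l * s₂))) s₁²≡1 ⟩
  - (+ 1 * (l * s₂))         ∎
  where open ≡-Reasoning

-- Fractions and phases

infix 4 _≐_/_

record _≐_/_ (q : ℚᵘ) (n d : ℤ) : Set where
  constructor mk≐
  field cross : ↥ q * d ≡ n * ↧ q

÷-≐ : ∀ n d .{{_ : ℕ.NonZero d}} → n ÷ d ≐ n / + d
÷-≐ n (suc d) = mk≐ refl

≐-cong : ∀ {q n n′ d d′} → n ≡ n′ → d ≡ d′ → q ≐ n / d → q ≐ n′ / d′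
≐-cong refl refl q≐n/d = q≐n/d

≐-neg : ∀ {q n d} → q ≐ n / d → Q.- q ≐ - n / d
≐-neg {mkℚᵘ x _} {n} {d} (mk≐ cross) = mk≐ (begin
  - x * d     ≡⟨ ℤP.neg-distribˡ-* x d ⟨
  - (x * d)   ≡⟨ cong -_ cross ⟩
  - (n * _)   ≡⟨ ℤP.neg-distribˡ-* n _ ⟩
  - n * _     ∎)
  where open ≡-Reasoning

≐-+ : ∀ {q r n₁ n₂ d₁ d₂} → q ≐ n₁ / d₁ → r ≐ n₂ / d₂ →
      q Q.+ r ≐ n₁ * d₂ + n₂ * d₁ / d₁ * d₂
≐-+ {q@(mkℚᵘ x _)} {r@(mkℚᵘ y _)} {n₁} {n₂} {d₁} {d₂} (mk≐ cross₁) (mk≐ cross₂) =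
  mk≐ (cross-+ x y (↧ q) (↧ r) n₁ n₂ d₁ d₂ cross₁ cross₂)
  where
  cross-+ : ∀ x y X Y n₁ n₂ d₁ d₂ → x * d₁ ≡ n₁ * X → y * d₂ ≡ n₂ * Y →
            (x * Y + y * X) * (d₁ * d₂) ≡ (n₁ * d₂ + n₂ * d₁) * (X * Y)
  cross-+ x y X Y n₁ n₂ d₁ d₂ e₁ e₂ = begin
    (x * Y + y * X) * (d₁ * d₂)
      ≡⟨ solve (x ∷ y ∷ X ∷ Y ∷ d₁ ∷ d₂ ∷ []) ⟩
    (x * d₁) * (Y * d₂) + (y * d₂) * (X * d₁)
      ≡⟨ cong₂ (λ a b → a * (Y * d₂) + b * (X * d₁)) e₁ e₂ ⟩
    (n₁ * X) * (Y * d₂) + (n₂ * Y) * (X * d₁)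
      ≡⟨ solve (X ∷ Y ∷ n₁ ∷ n₂ ∷ d₁ ∷ d₂ ∷ []) ⟩
    (n₁ * d₂ + n₂ * d₁) * (X * Y) ∎
    where open ≡-Reasoning

≐-+-common : ∀ {q r n₁ n₂ d} → q ≐ n₁ / d → r ≐ n₂ / d → q Q.+ r ≐ n₁ + n₂ / d
≐-+-common {q@(mkℚᵘ x _)} {r@(mkℚᵘ y _)} {n₁} {n₂} {d} (mk≐ cross₁) (mk≐ cross₂) =
  mk≐ (cross-+ x y (↧ q) (↧ r) cross₁ cross₂)
  where
  cross-+ : ∀ x y X Y → x * d ≡ n₁ * X → y * d ≡ n₂ * Y →
            (x * Y + y * X) * d ≡ (n₁ + n₂) * (X * Y)
  cross-+ x y X Y e₁ e₂ = begin
    (x * Y + y * X) * d          ≡⟨ solve (x ∷ y ∷ X ∷ Y ∷ d ∷ []) ⟩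
    (x * d) * Y + (y * d) * X     ≡⟨ cong₂ (λ a b → a * Y + b * X) e₁ e₂ ⟩
    (n₁ * X) * Y + (n₂ * Y) * X   ≡⟨ solve (X ∷ Y ∷ n₁ ∷ n₂ ∷ []) ⟩
    (n₁ + n₂) * (X * Y)          ∎
    where open ≡-Reasoning

≐-* : ∀ {q r n₁ n₂ d₁ d₂} → q ≐ n₁ / d₁ → r ≐ n₂ / d₂ → q Q.* r ≐ n₁ * n₂ / d₁ * d₂
≐-* {q@(mkℚᵘ x _)} {r@(mkℚᵘ y _)} {n₁} {n₂} {d₁} {d₂} (mk≐ cross₁) (mk≐ cross₂) =
  mk≐ (cross-* x y (↧ q) (↧ r) cross₁ cross₂)
  where
  cross-* : ∀ x y X Y → x * d₁ ≡ n₁ * X → y * d₂ ≡ n₂ * Y →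
            (x * y) * (d₁ * d₂) ≡ (n₁ * n₂) * (X * Y)
  cross-* x y X Y e₁ e₂ = begin
    (x * y) * (d₁ * d₂)     ≡⟨ solve (x ∷ y ∷ d₁ ∷ d₂ ∷ []) ⟩
    (x * d₁) * (y * d₂)     ≡⟨ cong₂ _*_ e₁ e₂ ⟩
    (n₁ * X) * (n₂ * Y)     ≡⟨ solve (X ∷ Y ∷ n₁ ∷ n₂ ∷ []) ⟩
    (n₁ * n₂) * (X * Y)     ∎
    where open ≡-Reasoning

≐-rescale : ∀ {q n d} → q ≐ n / d → ∀ g {d′} → d * g ≡ d′ → q ≐ n * g / d′
≐-rescale {q@(mkℚᵘ x _)} {n} {d} (mk≐ cross) g refl = mk≐ (begin
  x * (d * g)    ≡⟨ ℤP.*-assoc x d g ⟨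
  x * d * g      ≡⟨ cong (_* g) cross ⟩
  n * ↧ q * g    ≡⟨ xy∙z≈xz∙y n (↧ q) g ⟩
  n * g * ↧ q    ∎)
  where open ≡-Reasoning

≐-integral : ∀ {q n d} .{{_ : ℤ.NonZero d}} → q ≐ n / d → d ℤˢ.∣ n → ∃ λ z → q Q.≃ mkℚᵘ z 0
≐-integral {q@(mkℚᵘ x _)} {d = d} (mk≐ cross) (ℤˢ.divides z refl) =
  z , *≡* (ℤP.*-cancelʳ-≡ (x * + 1) (z * ↧ q) d (begin
    x * + 1 * d    ≡⟨ cong (_* d) (ℤP.*-identityʳ x) ⟩
    x * d          ≡⟨ cross ⟩
    z * d * ↧ q    ≡⟨ xy∙z≈xz∙y z d (↧ q) ⟩
    z * ↧ q * d    ∎))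
  where open ≡-Reasoning

oddPhase : ℤ → ℕ → ℤ → ℚᵘ
oddPhase a c a′ = Q.- ((((+ 2 - a * + c - a) ÷ 4) Q.+ omegaTail a c a′) Q.* mkℚᵘ (+ 1) 1)

omega-odd : ∀ a c a′ → ∣ a ∣ % 2 ≡ 1 → omega a c a′ ≡ (kronecker (- + c) a , oddPhase a c a′)
omega-odd a c a′ a-odd rewrite a-odd = refl

oddPhaseNumerator : ℤ → ℤ → ℤ → ℤ
oddPhaseNumerator a C a′ =
  - ((+ 2 - a * C - a) * (+ 12 * C) + ((C * C - + 1) * (+ 2 * a - a′ + a * a * a′)) * + 4)

oddPhase-≐ : ∀ a c .{{_ : ℕ.NonZero c}} a′ →
             oddPhase a c a′ ≐ oddPhaseNumerator a (+ c) a′ / + 96 * + c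
oddPhase-≐ a c@(suc _) a′ =
  ≐-cong (cong -_ (ℤP.*-identityʳ _)) (denominator (+ c))
    (≐-neg (≐-* (≐-+ (÷-≐ (+ 2 - a * + c - a) 4)
                     (÷-≐ ((+ (c ℕ.* c) - + 1) * (+ 2 * a - a′ + a * a * a′)) (12 ℕ.* c)))
                (÷-≐ (+ 1) 2)))
  where
  denominator : ∀ C → + 4 * (+ 12 * C) * + 2 ≡ + 96 * C
  denominator = solve-∀

rhsPhase : ℕ → ℤ → ℤ → ℚᵘ
rhsPhase k h h′ =
  (((+ (k ℕ.* (k ℕ.+ 2)) * h) ÷ 8) Q.- ((+ (k ℕ.* k ℕ.+ 2) * h′) ÷ 18)) Q.* ((+ 1) ÷ k)

rhsPhaseNumerator : ℤ → ℤ → ℤ → ℤ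
rhsPhaseNumerator K h h′ = K * (K + + 2) * h * + 18 + - ((K * K + + 2) * h′) * + 8

rhsPhase-≐ : ∀ k .{{_ : ℕ.NonZero k}} h h′ →
             rhsPhase k h h′ ≐ rhsPhaseNumerator (+ k) h h′ / + 144 * + k
rhsPhase-≐ k@(suc _) h h′ =
  ≐-cong (ℤP.*-identityʳ _) refl
    (≐-* (≐-+ (÷-≐ (+ (k ℕ.* (k ℕ.+ 2)) * h) 8) (≐-neg (÷-≐ (+ (k ℕ.* k ℕ.+ 2) * h′) 18)))
         (÷-≐ (+ 1) k))

phaseDefect : ℕ → ℕ → ℤ → ℤ → ℤ → ℤ → ℤ → ℤ → ℚᵘ
phaseDefect k m h h′ a₁ a₂ a₃ a₄ =
  ((oddPhase h k a₁ Q.+ oddPhase h m a₂) Q.+ oddPhase (+ 3 * h) k a₃)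
  Q.- ((rhsPhase k h h′ Q.+ oddPhase (+ 3 * h) m a₄) Q.+ mkℚᵘ (+ 1) 1)

phaseDefectNumerator : ℤ → ℤ → ℤ → ℤ → ℤ → ℤ → ℤ → ℤ → ℤ
phaseDefectNumerator K M h h′ a₁ a₂ a₃ a₄ =
  (oddPhaseNumerator h K a₁ * + 3 + oddPhaseNumerator h M a₂ * + 6
    + oddPhaseNumerator (+ 3 * h) K a₃ * + 3)
  - (rhsPhaseNumerator K h h′ * + 2 + oddPhaseNumerator (+ 3 * h) M a₄ * + 6 + + 1 * (+ 288 * M))

phaseDefect-≐ : ∀ k m .{{_ : ℕ.NonZero k}} .{{_ : ℕ.NonZero m}} h h′ a₁ a₂ a₃ a₄ →
  + k ≡ + 2 * + m →
  phaseDefect k m h h′ a₁ a₂ a₃ a₄ ≐ phaseDefectNumerator (+ k) (+ m) h h′ a₁ a₂ a₃ a₄ / + 576 * + m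
phaseDefect-≐ k m h h′ a₁ a₂ a₃ a₄ k≡2m =
  ≐-+-common
    (≐-+-common
      (≐-+-common (≐-rescale (oddPhase-≐ h k a₁) (+ 3) (over-k (+ 96) (+ 3) refl))
                  (≐-rescale (oddPhase-≐ h m a₂) (+ 6) (over-m (+ 96) (+ 6) refl)))
      (≐-rescale (oddPhase-≐ (+ 3 * h) k a₃) (+ 3) (over-k (+ 96) (+ 3) refl)))
    (≐-neg
      (≐-+-common
        (≐-+-common (≐-rescale (rhsPhase-≐ k h h′) (+ 2) (over-k (+ 144) (+ 2) refl))
                    (≐-rescale (oddPhase-≐ (+ 3 * h) m a₄) (+ 6) (over-m (+ 96) (+ 6) refl)))
        (≐-rescale (÷-≐ (+ 1) 2) (+ 288 * + m) (sym (ℤP.*-assoc (+ 2) (+ 288) (+ m))))))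
  where
  over-m : ∀ d g → d * g ≡ + 576 → d * + m * g ≡ + 576 * + m
  over-m d g dg≡576 = trans (xy∙z≈xz∙y d (+ m) g) (cong (_* + m) dg≡576)
  over-k : ∀ d g → d * + 2 * g ≡ + 576 → d * + k * g ≡ + 576 * + m
  over-k d g d2g≡576 = begin
    d * + k * g            ≡⟨ cong (λ K → d * K * g) k≡2m ⟩
    d * (+ 2 * + m) * g    ≡⟨ cong (_* g) (ℤP.*-assoc d (+ 2) (+ m)) ⟨
    d * + 2 * + m * g      ≡⟨ over-m (d * + 2) g d2g≡576 ⟩
    + 576 * + m            ∎
    where open ≡-Reasoning

phaseDefectNumerator-∣ : ∀ {K M h h′ s a₁ a₂ a₃ a₄} → K ≡ + 2 * M → h′ ≡ s * + 3 →
  a₁ ≡[mod K ] h′ → a₂ ≡[mod M ] h′ → a₃ ≡[mod K ] s → a₄ ≡[mod M ] s →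
  + 8 ℤˢ.∣ h * h - + 1 → + 3 ℤˢ.∣ K * K - + 1 → + 3 ℤˢ.∣ M * M - + 1 →
  + 576 * M ℤˢ.∣ phaseDefectNumerator K M h h′ a₁ a₂ a₃ a₄
phaseDefectNumerator-∣ {M = M} {h} {s = s}
  refl refl (u₁ , refl) (u₂ , refl) (u₃ , refl) (u₄ , refl)
  (ℤˢ.divides t h²-1≡t*8) (ℤˢ.divides y K²-1≡y*3) (ℤˢ.divides z M²-1≡z*3) =
  ℤˢ.divides (- (+ 1 + t * (y * u₁ + z * u₂ + + 6 * M * s) + (+ 9 * t + + 1) * (y * u₃ - z * u₄)))
  (begin
    phaseDefectNumerator K M h h′ a₁ a₂ a₃ a₄
      ≡⟨ in-squares h M s u₁ u₂ u₃ u₄ ⟩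
    F (h * h - + 1) (K * K - + 1) (M * M - + 1)
      ≡⟨ cong (λ X → F X (K * K - + 1) (M * M - + 1)) h²-1≡t*8 ⟩
    F (t * + 8) (K * K - + 1) (M * M - + 1)
      ≡⟨ cong₂ (F (t * + 8)) K²-1≡y*3 M²-1≡z*3 ⟩
    - (+ 576 * M + + 24 * M * (t * + 8 * (y * + 3 * u₁ + z * + 3 * u₂ + + 18 * M * s)
                               + (+ 9 * (t * + 8) + + 8) * (y * + 3 * u₃ - z * + 3 * u₄)))
      ≡⟨ solve (M ∷ s ∷ u₁ ∷ u₂ ∷ u₃ ∷ u₄ ∷ t ∷ y ∷ z ∷ []) ⟩
    - (+ 1 + t * (y * u₁ + z * u₂ + + 6 * M * s) + (+ 9 * t + + 1) * (y * u₃ - z * u₄))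
      * (+ 576 * M) ∎)
  where
  open ≡-Reasoning
  K = + 2 * M
  h′ = s * + 3
  a₁ = h′ + u₁ * K
  a₂ = h′ + u₂ * M
  a₃ = s + u₃ * K
  a₄ = s + u₄ * M

  F : ℤ → ℤ → ℤ → ℤ
  F X Y Z = - (+ 576 * M + + 24 * M * (X * (Y * u₁ + Z * u₂ + + 18 * M * s)
                                      + (+ 9 * X + + 8) * (Y * u₃ - Z * u₄)))

  -- The ring solver does not unfold definitions, so the numerators are restated here.
  in-squares : ∀ h M s u₁ u₂ u₃ u₄ →
    let K = + 2 * M
        h′ = s * + 3
        N : ℤ → ℤ → ℤ → ℤ
        N a C a′ = - ((+ 2 - a * C - a) * (+ 12 * C)
                      + ((C * C - + 1) * (+ 2 * a - a′ + a * a * a′)) * + 4)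
        E : ℤ → ℤ → ℤ → ℤ
        E C b b′ = C * (C + + 2) * b * + 18 + - ((C * C + + 2) * b′) * + 8
        F : ℤ → ℤ → ℤ → ℤ
        F X Y Z = - (+ 576 * M + + 24 * M * (X * (Y * u₁ + Z * u₂ + + 18 * M * s)
                                            + (+ 9 * X + + 8) * (Y * u₃ - Z * u₄)))
    in (N h K (h′ + u₁ * K) * + 3 + N h M (h′ + u₂ * M) * + 6
         + N (+ 3 * h) K (s + u₃ * K) * + 3)
       - (E K h h′ * + 2 + N (+ 3 * h) M (s + u₄ * M) * + 6 + + 1 * (+ 288 * M))
       ≡ F (h * h - + 1) (K * K - + 1) (M * M - + 1)
  in-squares = solve-∀

-- q and r are explicit: inferring them from a goal would unfold the ℚᵘ operations.
≈-antipodal : ∀ {s t} q r → s ≡ - t → q ≡mod1 (r Q.+ mkℚᵘ (+ 1) 1) → (s , q) ≈ (t , r)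
≈-antipodal {t = t} q r s≡-t q≡r+½ with t ℤ.≟ + 0
... | yes refl = inj₁ (s≡-t , refl)
... | no t≢0   = inj₂ (inj₂ ((s≡-t , s≢0) , q≡r+½))
  where
  s≢0 : ¬ _ ≡ + 0
  s≢0 s≡0 = t≢0 (ℤP.neg-injective (trans (sym s≡-t) s≡0))

module Setting {k m : ℕ} (k≡2m : k ≡ 2 ℕ.* m) (3∤k : ¬ 3 ∣ₙ k) {h : ℤ} (k⊥h : Coprime k ∣ h ∣) where

  private
    m∣k : m ∣ₙ k
    m∣k = ℕᵈ.divides 2 k≡2m

    3∤m : ¬ 3 ∣ₙ m
    3∤m 3∣m = 3∤k (ℕᵈ.∣-trans 3∣m m∣k)

    instance
      k≢0 : ℕ.NonZero k
      k≢0 = ℕ.≢-nonZero λ k≡0 → 3∤k (subst (3 ∣ₙ_) (sym k≡0) (ℕᵈ._∣0 3))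
      m≢0 : ℕ.NonZero m
      m≢0 = ℕ.≢-nonZero λ m≡0 → 3∤m (subst (3 ∣ₙ_) (sym m≡0) (ℕᵈ._∣0 3))

    coprime⇒¬2∣ : ∀ n → Coprime k n → ¬ 2 ∣ₙ n
    coprime⇒¬2∣ n k⊥n 2∣n =
      contradiction (k⊥n (ℕᵈ.divides m (trans k≡2m (ℕP.*-comm 2 m)) , 2∣n)) λ ()

    k⊥3h : Coprime k ∣ + 3 * h ∣
    k⊥3h = subst (Coprime k) (sym (ℤP.abs-* (+ 3) h))
                 (coprime-*ʳ (¬∣⇒coprime (from-yes (prime? 3)) 3∤k) k⊥h)

  h-odd : ∣ h ∣ % 2 ≡ 1
  h-odd = ¬2∣⇒%2≡1 ∣ h ∣ (coprime⇒¬2∣ ∣ h ∣ k⊥h)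

  3h-odd : ∣ + 3 * h ∣ % 2 ≡ 1
  3h-odd = ¬2∣⇒%2≡1 ∣ + 3 * h ∣ (coprime⇒¬2∣ ∣ + 3 * h ∣ k⊥3h)

  omega-signs : kronecker (- + k) h * kronecker (- + m) h * kronecker (- + k) (+ 3 * h)
                ≡ - (+ 1 * kronecker (- + m) (+ 3 * h))
  omega-signs =
    sign-identity {l = kronPrime (- + m) 3}
      (∣i∣≡1⇒i*i≡1 {kronecker (- + k) h} (kronecker-unit (- + k) h h≢0 units))
      (trans (kronecker-3* (- + k) h h-odd) (cong (_* kronecker (- + k) h) -k/3≡-[-m/3]))
      (kronecker-3* (- + m) h h-odd)
    where
    h≢0 : h ≢ + 0
    h≢0 h≡0 = coprime⇒¬2∣ ∣ h ∣ k⊥h (subst (λ i → 2 ∣ₙ ∣ i ∣) (sym h≡0) (ℕᵈ._∣0 2))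
    units : ∀ l → 2 ℕ.+ l ∣ₙ ∣ h ∣ → ∣ kronPrime (- + k) (2 ℕ.+ l) ∣ ≡ 1
    units zero    2∣h = ⊥-elim (coprime⇒¬2∣ ∣ h ∣ k⊥h 2∣h)
    units (suc l) p∣h = kronPrime-unit (- + k) l λ p∣k →
      contradiction (k⊥h (subst (3 ℕ.+ l ∣ₙ_) (ℤP.∣-i∣≡∣i∣ (+ k)) p∣k , p∣h)) λ ()
    -k/3≡-[-m/3] : kronPrime (- + k) 3 ≡ - kronPrime (- + m) 3
    -k/3≡-[-m/3] = subst (λ n → kronPrime (- + n) 3 ≡ - kronPrime (- + m) 3) (sym k≡2m)
                         (kronPrime[-2m,3]≡-kronPrime[-m,3] m 3∤m)

  phaseDefect-integral : ∀ h′ → + k ∣ h * h′ + + 1 → + 3 ∣ h′ → ∀ a₁ a₂ a₃ a₄ →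
    + k ∣ h * a₁ + + 1 → + m ∣ h * a₂ + + 1 → + k ∣ + 3 * h * a₃ + + 1 → + m ∣ + 3 * h * a₄ + + 1 →
    ∃ λ n → phaseDefect k m h h′ a₁ a₂ a₃ a₄ Q.≃ mkℚᵘ n 0
  phaseDefect-integral h′ k∣hh′+1 3∣h′ a₁ a₂ a₃ a₄ k∣ha₁+1 m∣ha₂+1 k∣3ha₃+1 m∣3ha₄+1 =
    ≐-integral {{ℤP.i*j≢0 (+ 576) (+ m)}} (phaseDefect-≐ k m h h′ a₁ a₂ a₃ a₄ K≡2M)
      (phaseDefectNumerator-∣ {h = h} {s = s} K≡2M h′≡s*3
        (inverse-unique (+ k) h a₁ h′ k⊥h k∣ha₁+1 k∣hh′+1)
        (inverse-unique (+ m) h a₂ h′ (coprime-∣ˡ ∣ h ∣ m∣k k⊥h) m∣ha₂+1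
                        (ℕᵈ.∣-trans m∣k k∣hh′+1))
        (inverse-unique (+ k) (+ 3 * h) a₃ s k⊥3h k∣3ha₃+1 k∣3hs+1)
        (inverse-unique (+ m) (+ 3 * h) a₄ s (coprime-∣ˡ ∣ + 3 * h ∣ m∣k k⊥3h) m∣3ha₄+1
                        (ℕᵈ.∣-trans m∣k k∣3hs+1))
        (¬2∣⇒8∣i*i-1 h (coprime⇒¬2∣ ∣ h ∣ k⊥h))
        (¬3∣⇒3∣i*i-1 (+ k) 3∤k)
        (¬3∣⇒3∣i*i-1 (+ m) 3∤m))
    where
    K≡2M : + k ≡ + 2 * + m
    K≡2M = trans (cong +_ k≡2m) (ℤP.pos-* 2 m)
    open ℤˢ._∣_ (ℤˢ.∣ᵤ⇒∣ {+ 3} {h′} 3∣h′) renaming (quotient to s; equality to h′≡s*3)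
    k∣3hs+1 : + k ∣ + 3 * h * s + + 1
    k∣3hs+1 = subst (λ x → + k ∣ x + + 1) (trans (cong (h *_) h′≡s*3) (rearrange h s)) k∣hh′+1
      where
      rearrange : ∀ h s → h * (s * + 3) ≡ + 3 * h * s
      rearrange = solve-∀

  omega-relation : ∀ h′ → + k ∣ h * h′ + + 1 → + 3 ∣ h′ → ∀ a₁ a₂ a₃ a₄ →
    + k ∣ h * a₁ + + 1 → + m ∣ h * a₂ + + 1 → + k ∣ + 3 * h * a₃ + + 1 → + m ∣ + 3 * h * a₄ + + 1 →
    (omega h k a₁ · omega h m a₂) · omega (+ 3 * h) k a₃
      ≈ e (rhsPhase k h h′) · omega (+ 3 * h) m a₄
  omega-relation h′ k∣hh′+1 3∣h′ a₁ a₂ a₃ a₄ k∣ha₁+1 m∣ha₂+1 k∣3ha₃+1 m∣3ha₄+1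
    rewrite omega-odd h k a₁ h-odd | omega-odd h m a₂ h-odd
          | omega-odd (+ 3 * h) k a₃ 3h-odd | omega-odd (+ 3 * h) m a₄ 3h-odd =
    ≈-antipodal (oddPhase h k a₁ Q.+ oddPhase h m a₂ Q.+ oddPhase (+ 3 * h) k a₃)
                (rhsPhase k h h′ Q.+ oddPhase (+ 3 * h) m a₄) omega-signs
      (phaseDefect-integral h′ k∣hh′+1 3∣h′ a₁ a₂ a₃ a₄ k∣ha₁+1 m∣ha₂+1 k∣3ha₃+1 m∣3ha₄+1)

lemma3p4 : (k : ℕ) → gcd k 6 ≡ 2 →
    (h : ℤ) → ℤG.gcd h (+ k) ≡ + 1 →
    (h' : ℤ) → (+ k) ∣ (h ℤ.* h' ℤ.+ + 1) → (+ 3) ∣ h' →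
    (a₁ a₂ a₃ a₄ : ℤ) →
    (+ k) ∣ (h ℤ.* a₁ ℤ.+ + 1) →
    (+ (k / 2)) ∣ (h ℤ.* a₂ ℤ.+ + 1) →
    (+ k) ∣ ((+ 3 ℤ.* h) ℤ.* a₃ ℤ.+ + 1) →
    (+ (k / 2)) ∣ ((+ 3 ℤ.* h) ℤ.* a₄ ℤ.+ + 1) →
    (omega h k a₁ · omega h (k / 2) a₂) · omega (+ 3 ℤ.* h) k a₃
      ≈ e ((((+ (k ℕ.* (k ℕ.+ 2)) ℤ.* h) ÷ 8) Q.- ((+ (k ℕ.* k ℕ.+ 2) ℤ.* h') ÷ 18))
             Q.* ((+ 1) ÷ k))
        · omega (+ 3 ℤ.* h) (k / 2) a₄
lemma3p4 k gcd[k,6]≡2 h gcd[h,k]≡1 =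
  Setting.omega-relation k≡2m 3∤k {h} (ℕC.sym (ℕC.gcd≡1⇒coprime (ℤP.+-injective gcd[h,k]≡1)))
  where
  2∣k : 2 ∣ₙ k
  2∣k = subst (_∣ₙ k) gcd[k,6]≡2 (gcd[m,n]∣m k 6)
  3∤k : ¬ 3 ∣ₙ k
  3∤k 3∣k =
    from-no (3 ℕᵈ.∣? 2) (subst (3 ∣ₙ_) gcd[k,6]≡2 (gcd-greatest 3∣k (ℕᵈ.divides 2 refl)))
  k≡2m : k ≡ 2 ℕ.* (k / 2)
  k≡2m = trans (sym (ℕD.m/n*n≡m 2∣k)) (ℕP.*-comm (k / 2) 2)
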